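{- Let $U$ be a linear numeration system satisfying (H1), (H2) and (H3). Let $p$ be a prime not dividing all the coefficients $a_0,\ldots,a_{k-1}$ of its recurrence relation, and let $\lambda\ge1$ be an integer such that the periodic part of the sequence $(U_i\bmod p^\lambda)_{i\ge0}$ contains a non-zero element. If $X\subseteq\mathbb{N}$ is an ultimately periodic $U$-recognizable set with period $\pi_X=p^\mu\cdot r$ where $\mu\ge\lambda$ and $r$ is not divisible by $p$, then the minimal automaton of $\operatorname{rep}_U(X)$ has at least $p^{\mu-\lambda+1}$ states.
   Context: A numeration system is an increasing sequence $U=(U_i)_{i\ge0}$ of integers with $U_0=1$ such that $C_U=\sup_{i}\lceil U_{i+1}/U_i\rceil$ is finite; $A_U=\{0,\ldots,C_U-1\}$. For $n\ge1$, $\operatorname{rep}_U(n)=w_\ell\cdots w_0$ is the unique word over $A_U$ with $n=\sum w_iU_i$, $w_\ell\ne0$ and $\sum_{i=0}^t w_iU_i<U_{t+1}$ for $t=0,\ldots,\ell$; $\operatorname{rep}_U(0)$ is the empty word; $X$ is $U$-recognizable if $\operatorname{rep}_U(X)$ is regular. $U$ is linear if there exist $k\ge1$, integers $a_0\neq0,a_1,\ldots,a_{k-1}$ (the coefficients) and $N\ge0$ with $U_{i+k}=a_{k-1}U_{i+k-1}+\cdots+a_0U_i$ for all $i\ge N$ ($k$, then $N$, minimal). (H1): $\operatorname{rep}_U(\mathbb{N})$ is regular. (H2): $\limsup_{i}(U_{i+1}-U_i)=+\infty$. (H3): there is $G\ge0$ with $U_{i+1}-U_i\le U_{i+2}-U_{i+1}$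 for all $i\ge G$. A set $X$ is ultimately periodic if its characteristic sequence is $uv^\omega$; with $u,v$ of minimal length, its period is $\pi_X=|v|$. The periodic part of an ultimately periodic sequence is the set of values it takes infinitely often (the repeated block). -}

module Defs where

open import Data.Nat using (ℕ; zero; suc; _+_; _*_; _∸_; _^_; _≤_; _<_)
open import Data.Nat.DivMod using (_%_)
open import Data.Nat.Divisibility using (_∣_)
open import Data.Integer as ℤ using (ℤ; +_)
open import Data.Fin using (Fin; toℕ)
open import Data.List using (List; []; _∷_; reverse; take; foldl)
open import Data.Bool using (Bool; true)
open import Data.Product using (Σ; _×_; ∃; ∃-syntax; _,_)
open import Relation.Nullary using (¬_)
open import Relation.Binary.PropositionalEquality using (_≡_; _≢_)
open import Function.Bundles using (_⇔_)

-- A numeration system: U increasing, U 0 = 1, and C = C_U = sup_i ⌈U(i+1)/U i⌉.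
-- ⌈U(i+1)/U i⌉ ≤ C  iff  U(i+1) ≤ C * U i, and the sup is attained
-- (integers), i.e. some ⌈U(i+1)/U i⌉ = C, i.e. (C-1) * U i < U(i+1).
record NumSys : Set where
  field
    U        : ℕ → ℕ
    U0       : U 0 ≡ 1
    incr     : ∀ i → U i < U (suc i)
    C        : ℕ
    C-bound  : ∀ i → U (suc i) ≤ C * U i
    C-sup    : ∃[ i ] ((C ∸ 1) * U i < U (suc i))

module _ (S : NumSys) where
  open NumSys S

  Word : Set
  Word = List (Fin C)

  valFrom : ℕ → List (Fin C) → ℕ
  valFrom i []       = 0
  valFrom i (d ∷ ds) = toℕ d * U i + valFrom (suc i) ds

  LeadingNonzero : Word → Set
  LeadingNonzero []      = Data.Unit.⊤ where import Data.Unit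
  LeadingNonzero (d ∷ _) = toℕ d ≢ 0

  -- w = w_ℓ ⋯ w_0 (most significant digit first) is rep_U(n)
  IsRep : Word → ℕ → Set
  IsRep w n = valFrom 0 (reverse w) ≡ n
            × LeadingNonzero w
            × (∀ t → valFrom 0 (take (suc t) (reverse w)) < U (suc t))

  RepLang : (ℕ → Set) → Word → Set
  RepLang X w = ∃[ n ] (X n × IsRep w n)

record DFA (m c : ℕ) : Set where
  field
    init  : Fin m
    δ     : Fin m → Fin c → Fin m
    final : Fin m → Bool

run : ∀ {m c} → DFA m c → Fin m → List (Fin c) → Fin m
run D q []       = q
run D q (a ∷ w) = run D (DFA.δ D q a) w

Accepts : ∀ {m c} → DFA m c → List (Fin c) → Set
Accepts D w = DFA.final D (run D (DFA.init D) w) ≡ true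

Recognizes : ∀ {m c} → DFA m c → (List (Fin c) → Set) → Set
Recognizes D L = ∀ w → Accepts D w ⇔ L w

Regular : ∀ {c} → (List (Fin c) → Set) → Set
Regular {c} L = ∃[ m ] Σ (DFA m c) (λ D → Recognizes D L)

MinAutAtLeast : ∀ {c} → (List (Fin c) → Set) → ℕ → Set
MinAutAtLeast {c} L b = ∀ m (D : DFA m c) → Recognizes D L → b ≤ m

recSum : ∀ (U : ℕ → ℕ) k → (Fin k → ℤ) → ℕ → ℤ
recSum U zero    a i = + 0
recSum U (suc k) a i = a Fin.zero ℤ.* (+ U i) ℤ.+ recSum U k (λ j → a (Fin.suc j)) (suc i)
  where import Data.Fin as Fin

LinRec : (U : ℕ → ℕ) (k : ℕ) → (Fin k → ℤ) → ℕ → Set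
LinRec U zero    a N = Data.Empty.⊥ where import Data.Empty
LinRec U (suc k) a N = (a Data.Fin.zero ≢ + 0)
                     × (∀ i → N ≤ i → + U (i + suc k) ≡ recSum U (suc k) a i)

IsLinearWith : (U : ℕ → ℕ) (k : ℕ) → (Fin k → ℤ) → ℕ → Set
IsLinearWith U k a N =
    LinRec U k a N
  × (∀ k' (a' : Fin k' → ℤ) N' → LinRec U k' a' N' → k ≤ k')
  × (∀ (a' : Fin k → ℤ) N' → LinRec U k a' N' → N ≤ N')

H1 : NumSys → Set
H1 S = Regular (RepLang S (λ _ → Data.Unit.⊤)) where import Data.Unit

H2 : NumSys → Set
H2 S = ∀ B M → ∃[ i ] (M ≤ i × B ≤ U (suc i) ∸ U i)
  where open NumSys S

H3 : NumSys → Set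
H3 S = ∃[ G ] ∀ i → G ≤ i → U (suc i) ∸ U i ≤ U (suc (suc i)) ∸ U (suc i)
  where open NumSys S

HasEventualPeriod : (ℕ → Bool) → ℕ → Set
HasEventualPeriod χ q = 1 ≤ q × ∃[ M ] ∀ n → M ≤ n → χ (n + q) ≡ χ n

IsPeriod : (ℕ → Bool) → ℕ → Set
IsPeriod χ π = HasEventualPeriod χ π × (∀ q → HasEventualPeriod χ q → π ≤ q)

-- the periodic part of (f i)_i (values taken infinitely often) contains a nonzero element
PeriodicPartHasNonzero : (ℕ → ℕ) → Set
PeriodicPartHasNonzero f = ∃[ v ] (v ≢ 0 × (∀ M → ∃[ i ] (M ≤ i × f i ≡ v)))

-- n mod m (only used with m ≥ 1; the m = 0 case is an arbitrary convention)
_mod_ : ℕ → ℕ → ℕ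
n mod zero  = n
n mod suc m = n % suc m

{-# OPTIONS --safe #-}
-- Let a DFA with m states recognize rep_U(X), and let P = p ^ μ. By (H2) and (H3) the gaps
-- U(q+1) − U q eventually exceed any bound, so one can choose positions q₀ < q₁ < … with
-- U q ≡ v (mod p ^ λ) so far apart that putting digits 1 at any initial segment of them, above
-- the greedy digits of any x < U π, is again a greedy representation. Among P·m + 1 such positions,
-- m + 1 have the same residue ρ of U q modulo P. Two of the words with ones at the first
-- a < b ≤ m + 1 of these positions lead the automaton to the same state, so X agrees at
-- x + Σ_{k<a} U q_k and x + Σ_{k<b} U q_k for all x < π. Hence d = Σ_{a≤k<b} U q_k is an eventual
-- period of X, so π ∣ d and P ∣ d ≡ (b − a) ρ (mod P); as ρ ≡ v ≢ 0 (mod p ^ λ),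
-- p ^ (μ − λ + 1) ∣ b − a ≤ m.
-- Linearity, (H1), the condition on the coefficients, λ ≥ 1 and p ∤ r are not needed.
module Submission where

open import Defs
open import Data.Bool using (Bool; true)
open import Data.Bool.Properties using (⇔→≡)
open import Data.Fin as Fin using (Fin; toℕ; fromℕ<)
open import Data.Fin.Properties using (pigeonhole; toℕ<n; toℕ-fromℕ<)
open import Data.Integer using (ℤ; ∣_∣)
open import Data.List using (List; []; _∷_; _++_; length; take; drop; map; reverse; replicate; filter; applyUpTo)
open import Data.List.Properties
  using (length-++; ++-assoc; reverse-involutive; reverse-++; take-all; length-take; length-drop; take-take;
         take++drop≡id; map-++; length-applyUpTo)
open import Data.List.Relation.Binary.Sublist.Propositional.Properties using (filter⁺; filter-⊆; length-mono-≤)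
open import Data.List.Relation.Unary.All as All using (All; []; _∷_)
import Data.List.Relation.Unary.All.Properties as All
open import Data.List.Relation.Unary.AllPairs using (AllPairs; []; _∷_)
import Data.List.Relation.Unary.AllPairs.Properties as AllPairs
open import Data.Nat
open import Data.Nat.Properties
open import Data.Nat.DivMod using (_/_; _%_; m≡m%n+[m/n]*n; m%n<n; m/n*n≤m; %-distribˡ-+)
open import Data.Nat.Divisibility
open import Data.Nat.ListAction using (sum)
open import Data.Nat.ListAction.Properties using (sum-++)
open import Data.Nat.Primality using (Prime; prime⇒nonZero; euclidsLemma)
open import Data.Nat.Tactic.RingSolver using (solve-∀)
open import Data.Product using (Σ-syntax; ∃; ∃₂; ∃-syntax; _×_; _,_; proj₁; proj₂)
open import Data.Sum using (inj₁; inj₂)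
open import Data.Unit using (⊤; tt)
open import Function using (id)
open import Function.Bundles using (Equivalence; mk⇔)
open import Level using (0ℓ)
open import Relation.Nullary using (¬_; yes; no; contradiction)
open import Relation.Unary using (Pred; Decidable)
open import Relation.Unary.Properties using (∁?)
open import Relation.Binary.PropositionalEquality

-- Prime powers and residues

^-monoʳ-∣ : ∀ p {m n} → m ≤ n → p ^ m ∣ p ^ n
^-monoʳ-∣ p {m} m≤n with k , refl ← m≤n⇒∃[o]m+o≡n m≤n =
  divides (p ^ k) (trans (^-distribˡ-+-* p m k) (*-comm (p ^ m) (p ^ k)))

module _ {p : ℕ} (p-prime : Prime p) where
  private instance
    p≢0 : NonZero p
    p≢0 = prime⇒nonZero p-prime

  prime^∣-coprime : ∀ {c} → ¬ p ∣ c → ∀ k d → p ^ k ∣ d * c → p ^ k ∣ d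
  prime^∣-coprime p∤c zero    d _ = 1∣ d
  prime^∣-coprime {c} p∤c (suc k) d pᵏ⁺¹∣dc
    with euclidsLemma d c p-prime (∣-trans (m∣m*n (p ^ k)) pᵏ⁺¹∣dc)
  ... | inj₂ p∣c = contradiction p∣c p∤c
  ... | inj₁ (divides q refl) =
    subst (p * p ^ k ∣_) (*-comm p q)
      (*-monoʳ-∣ p (prime^∣-coprime p∤c k q
        (*-cancelˡ-∣ p (subst (p * p ^ k ∣_) (reassoc q p c) pᵏ⁺¹∣dc))))
    where
    reassoc : ∀ q p c → q * p * c ≡ p * (q * c)
    reassoc = solve-∀

  -- the p-adic valuation of c is below l, so that of e is at least n + 1
  prime^∣-cancel : ∀ l n {c e} → p ^ (n + l) ∣ e * c → ¬ p ^ l ∣ c → p ^ (n + 1) ∣ e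
  prime^∣-cancel zero    n {c}     _       pˡ∤c = contradiction (1∣ c) pˡ∤c
  prime^∣-cancel (suc l) n {c} {e} pⁿ⁺ˡ∣ec pˡ∤c with p ∣? c
  ... | no p∤c = ∣-trans (^-monoʳ-∣ p (+-monoʳ-≤ n (s≤s z≤n))) (prime^∣-coprime p∤c (n + suc l) e pⁿ⁺ˡ∣ec)
  ... | yes (divides c′ refl) =
    prime^∣-cancel l n (*-cancelʳ-∣ p (subst₂ _∣_ (shift n l) (sym (*-assoc e c′ p)) pⁿ⁺ˡ∣ec))
      (λ pˡ∣c′ → pˡ∤c (subst (_∣ c′ * p) (*-comm (p ^ l) p) (*-monoˡ-∣ p pˡ∣c′)))
    where
    shift : ∀ n l → p ^ (n + suc l) ≡ p ^ (n + l) * p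
    shift n l = trans (cong (p ^_) (+-suc n l)) (*-comm p (p ^ (n + l)))

mono-from : ∀ (f : ℕ → ℕ) {G} → (∀ i → G ≤ i → f i ≤ f (suc i)) → ∀ {i j} → G ≤ i → i ≤ j → f i ≤ f j
mono-from f {G} step {i} G≤i i≤j = go (≤⇒≤′ i≤j)
  where
  go : ∀ {j} → i ≤′ j → f i ≤ f j
  go ≤′-refl       = ≤-refl
  go (≤′-step i≤j) = ≤-trans (go i≤j) (step _ (≤-trans G≤i (≤′⇒≤ i≤j)))

mod≡% : ∀ n m .{{_ : NonZero m}} → n mod m ≡ n % m
mod≡% n (suc m) = refl

sum-map-% : ∀ {A : Set} (f : A → ℕ) {d} .{{_ : NonZero d}} {c} xs →
            All (λ x → f x % d ≡ c % d) xs → sum (map f xs) % d ≡ (length xs * c) % d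
sum-map-% f {d} {c} []       []           = refl
sum-map-% f {d} {c} (x ∷ xs) (fx≡c ∷ fxs≡c) = begin
  (f x + sum (map f xs)) % d               ≡⟨ %-distribˡ-+ (f x) _ d ⟩
  (f x % d + sum (map f xs) % d) % d       ≡⟨ cong₂ (λ u w → (u + w) % d) fx≡c (sum-map-% f xs fxs≡c) ⟩
  (c % d + (length xs * c) % d) % d        ≡⟨ %-distribˡ-+ c _ d ⟨
  (c + length xs * c) % d                  ∎
  where open ≡-Reasoning

-- Lists

module _ {A : Set} {P : Pred A 0ℓ} (P? : Decidable P) where

  length-filter-∁ : ∀ xs → length (filter P? xs) + length (filter (∁? P?) xs) ≡ length xs
  length-filter-∁ []       = refl
  length-filter-∁ (x ∷ xs) with P? x
  ... | yes _ = cong suc (length-filter-∁ xs)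
  ... | no  _ = trans (+-suc _ _) (cong suc (length-filter-∁ xs))

module _ {A : Set} (colour : A → ℕ) where

  ofColour : ℕ → List A → List A
  ofColour ρ = filter (λ x → colour x ≟ ρ)

  colour-pigeonhole : ∀ R n xs → All (λ x → colour x < R) xs → R * n < length xs →
                      ∃[ ρ ] n < length (ofColour ρ xs)
  colour-pigeonhole zero    n []       _          ()
  colour-pigeonhole zero    n (x ∷ xs) (() ∷ _)   _
  colour-pigeonhole (suc R) n xs       colours<  big with n <? length (ofColour R xs)
  ... | yes many = R , many
  ... | no  few  =
    let ρ , many = colour-pigeonhole R n others others< others-big
    in  ρ , <-≤-trans many (length-mono-≤ (filter⁺ _ _ (λ { refl → id }) (filter-⊆ _ xs)))
    where
    others = filter (∁? (λ x → colour x ≟ R)) xs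
    others< : All (λ x → colour x < R) others
    others< = All.zipWith (λ (c≤R , c≢R) → ≤∧≢⇒< (≤-pred c≤R) c≢R)
                (All.filter⁺ _ colours< , All.all-filter _ xs)
    others-big : R * n < length others
    others-big = +-cancelˡ-< n (R * n) (length others) (begin-strict
      n + R * n                                 <⟨ big ⟩
      length xs                                 ≡⟨ sym (length-filter-∁ _ xs) ⟩
      length (ofColour R xs) + length others    ≤⟨ +-monoˡ-≤ _ (≮⇒≥ few) ⟩
      n + length others                         ∎)
      where open ≤-Reasoning

take-suc-≢[] : ∀ {A : Set} n {xs : List A} → xs ≢ [] → take (suc n) xs ≢ []
take-suc-≢[] n {[]}    []≢[] = contradiction refl []≢[]
take-suc-≢[] n {_ ∷ _} _     ()

∃-from-All : ∀ {A : Set} {P : A → Set} {xs} → All P xs → xs ≢ [] → ∃ P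
∃-from-All []        []≢[] = contradiction refl []≢[]
∃-from-All (px ∷ _) _     = _ , px

sum-map-≥ : ∀ {A : Set} (f : A → ℕ) {M} {xs} → All (λ x → M ≤ f x) xs → xs ≢ [] → M ≤ sum (map f xs)
sum-map-≥ f []         []≢[] = contradiction refl []≢[]
sum-map-≥ f (M≤fx ∷ _) _     = ≤-trans M≤fx (m≤m+n _ _)

-- Eventually periodic sequences

module _ {χ : ℕ → Bool} {π M : ℕ} (periodic : ∀ n → M ≤ n → χ (n + π) ≡ χ n) where

  periodic-* : ∀ k n → M ≤ n → χ (n + k * π) ≡ χ n
  periodic-* zero    n _   = cong χ (+-identityʳ n)
  periodic-* (suc k) n M≤n = begin
    χ (n + (π + k * π))   ≡⟨ cong χ (swap n π (k * π)) ⟩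
    χ (n + k * π + π)     ≡⟨ periodic (n + k * π) (≤-trans M≤n (m≤m+n n _)) ⟩
    χ (n + k * π)         ≡⟨ periodic-* k n M≤n ⟩
    χ n                   ∎
    where
    open ≡-Reasoning
    swap : ∀ a b c → a + (b + c) ≡ a + c + b
    swap a b c = trans (cong (a +_) (+-comm b c)) (sym (+-assoc a c b))

  window⇒period : .{{_ : NonZero π}} → ∀ {A d} → M ≤ A →
                  (∀ x → x < π → χ (x + A) ≡ χ (x + A + d)) → ∀ n → A ≤ n → χ (n + d) ≡ χ n
  window⇒period {A} {d} M≤A agree n A≤n = begin
    χ (n + d)                           ≡⟨ cong χ (trans (cong (_+ d) (sym y+A≡n)) (+-assoc y A d)) ⟩
    χ (y + (A + d))                     ≡⟨ cong χ (split (A + d)) ⟨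
    χ (y % π + (A + d) + (y / π) * π)   ≡⟨ periodic-* (y / π) _ (≤-trans M≤A (≤-trans (m≤m+n A d) (m≤n+m _ (y % π)))) ⟩
    χ (y % π + (A + d))                 ≡⟨ cong χ (sym (+-assoc (y % π) A d)) ⟩
    χ (y % π + A + d)                   ≡⟨ agree (y % π) (m%n<n y π) ⟨
    χ (y % π + A)                       ≡⟨ periodic-* (y / π) _ (≤-trans M≤A (m≤n+m A _)) ⟨
    χ (y % π + A + (y / π) * π)         ≡⟨ cong χ (trans (split A) y+A≡n) ⟩
    χ n                                 ∎
    where
    open ≡-Reasoning
    y = n ∸ A
    y+A≡n : y + A ≡ n
    y+A≡n = m∸n+n≡m A≤n
    split : ∀ Z → y % π + Z + (y / π) * π ≡ y + Z
    split Z = trans (swap (y % π) Z _) (cong (_+ Z) (sym (m≡m%n+[m/n]*n y π)))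
      where
      swap : ∀ a b c → a + b + c ≡ a + c + b
      swap = solve-∀

minimal-period-∣ : ∀ {χ π} → IsPeriod χ π → ∀ {d M} → (∀ n → M ≤ n → χ (n + d) ≡ χ n) → π ∣ d
minimal-period-∣ {χ} {suc π} ((_ , M₀ , periodic) , minimal) {d} {M} d-periodic with d % suc π ≟ 0
... | yes d%π≡0 = m%n≡0⇒n∣m d (suc π) d%π≡0
... | no  d%π≢0 = contradiction (minimal (d % suc π) (n≢0⇒n>0 d%π≢0 , M₀ ⊔ M , remainder-periodic))
                                (<⇒≱ (m%n<n d (suc π)))
  where
  remainder-periodic : ∀ n → M₀ ⊔ M ≤ n → χ (n + d % suc π) ≡ χ n
  remainder-periodic n M≤n = begin
    χ (n + d % suc π)                       ≡⟨ periodic-* periodic (d / suc π) _ (≤-trans M₀≤n (m≤m+n n _)) ⟨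
    χ (n + d % suc π + (d / suc π) * suc π) ≡⟨ cong χ (trans (+-assoc n _ _) (cong (n +_) (sym (m≡m%n+[m/n]*n d (suc π))))) ⟩
    χ (n + d)                               ≡⟨ d-periodic n (≤-trans (m≤n⊔m M₀ M) M≤n) ⟩
    χ n                                     ∎
    where
    open ≡-Reasoning
    M₀≤n = ≤-trans (m≤m⊔n M₀ M) M≤n

-- Automata

run-++ : ∀ {m c} (D : DFA m c) q u w → run D q (u ++ w) ≡ run D (run D q u) w
run-++ D q []      w = refl
run-++ D q (a ∷ u) w = run-++ D (DFA.δ D q a) u w

recognizes-residual : ∀ {m c} {D : DFA m c} {L} → Recognizes D L → ∀ {u u′} →
                      run D (DFA.init D) u ≡ run D (DFA.init D) u′ → ∀ w → L (u ++ w) → L (u′ ++ w)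
recognizes-residual {D = D} rec {u} {u′} same w u++w∈L =
  Equivalence.to (rec (u′ ++ w)) (subst (λ q → DFA.final D q ≡ true) final-state
    (Equivalence.from (rec (u ++ w)) u++w∈L))
  where
  final-state : run D (DFA.init D) (u ++ w) ≡ run D (DFA.init D) (u′ ++ w)
  final-state = trans (run-++ D _ u w) (trans (cong (λ q → run D q w) same) (sym (run-++ D _ u′ w)))

-- Greedy representations

module NumerationSystem (S : NumSys) where
  open NumSys S

  U-mono : ∀ {i j} → i ≤ j → U i ≤ U j
  U-mono = mono-from U (λ i _ → <⇒≤ (incr i)) z≤n

  n<U : ∀ n → n < U n
  n<U zero    = ≤-reflexive (sym U0)
  n<U (suc n) = ≤-<-trans (n<U n) (incr n)

  instance
    U≢0 : ∀ {i} → NonZero (U i)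
    U≢0 {i} = >-nonZero (≤-<-trans z≤n (n<U i))

  1<C : 1 < C
  1<C = ≤-trans (n<U 1) (subst (U 1 ≤_) (trans (cong (C *_) U0) (*-identityʳ C)) (C-bound 0))

  digit0 digit1 : Fin C
  digit0 = fromℕ< (<-trans z<s 1<C)
  digit1 = fromℕ< 1<C

  toℕ-digit0 : toℕ digit0 ≡ 0
  toℕ-digit0 = toℕ-fromℕ< _

  toℕ-digit1 : toℕ digit1 ≡ 1
  toℕ-digit1 = toℕ-fromℕ< 1<C

  val : ℕ → Word S → ℕ
  val = valFrom S

  val-++ : ∀ b l₁ l₂ → val b (l₁ ++ l₂) ≡ val b l₁ + val (b + length l₁) l₂
  val-++ b []       l₂ = cong (λ b → val b l₂) (sym (+-identityʳ b))
  val-++ b (d ∷ l₁) l₂ = begin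
    toℕ d * U b + val (suc b) (l₁ ++ l₂)                                   ≡⟨ cong (toℕ d * U b +_) (val-++ (suc b) l₁ l₂) ⟩
    toℕ d * U b + (val (suc b) l₁ + val (suc b + length l₁) l₂)            ≡⟨ sym (+-assoc (toℕ d * U b) _ _) ⟩
    toℕ d * U b + val (suc b) l₁ + val (suc (b + length l₁)) l₂            ≡⟨ cong (λ b′ → toℕ d * U b + val (suc b) l₁ + val b′ l₂) (sym (+-suc b (length l₁))) ⟩
    toℕ d * U b + val (suc b) l₁ + val (b + suc (length l₁)) l₂            ∎
    where open ≡-Reasoning

  -- the digits l sit at positions b, b + 1, … above a lower part of value acc, and every
  -- partial value stays below the U of the next position
  Greedy : ℕ → ℕ → Word S → Set
  Greedy b acc []      = acc < U b
  Greedy b acc (d ∷ l) = acc < U b × Greedy (suc b) (acc + toℕ d * U b) l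

  greedy-head : ∀ {b acc} l → Greedy b acc l → acc < U b
  greedy-head []      acc<U       = acc<U
  greedy-head (_ ∷ _) (acc<U , _) = acc<U

  greedy⇒prefix< : ∀ {b acc} l → Greedy b acc l → ∀ c → acc + val b (take c l) < U (b + c)
  greedy⇒prefix< {b} {acc} l g zero =
    subst₂ _<_ (sym (+-identityʳ acc)) (cong U (sym (+-identityʳ b))) (greedy-head l g)
  greedy⇒prefix< {b} {acc} [] g (suc c) =
    subst (_< U (b + suc c)) (sym (+-identityʳ acc)) (<-≤-trans g (U-mono (m≤m+n b (suc c))))
  greedy⇒prefix< {b} {acc} (d ∷ l) (_ , g) (suc c) =
    subst₂ _<_ (+-assoc acc _ _) (cong U (sym (+-suc b c))) (greedy⇒prefix< l g c)

  greedy-++ : ∀ {b acc} l₁ {l₂} → Greedy b acc l₁ → Greedy (b + length l₁) (acc + val b l₁) l₂ →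
              Greedy b acc (l₁ ++ l₂)
  greedy-++ {b} {acc} []       {l₂} _       g₂ = subst₂ (λ b acc → Greedy b acc l₂) (+-identityʳ b) (+-identityʳ acc) g₂
  greedy-++ {b} {acc} (d ∷ l₁) {l₂} (h , g) g₂ = h , greedy-++ l₁ g
    (subst₂ (λ b acc → Greedy b acc l₂) (+-suc b (length l₁)) (sym (+-assoc acc _ _)) g₂)

  paddedDigits : ∀ t x → x < U t → Σ[ zl ∈ Word S ] length zl ≡ t × val 0 zl ≡ x × Greedy 0 0 zl
  paddedDigits zero    x x<U = [] , refl , sym (n<1⇒n≡0 (subst (x <_) U0 x<U)) , n<U 0
  paddedDigits (suc t) x x<U with zl , refl , val≡ , g ← paddedDigits t (x % U t) (m%n<n x (U t)) =
    zl ++ d ∷ [] ,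
    trans (length-++ zl) (+-comm t 1) ,
    trans (val-++ 0 zl (d ∷ [])) (trans (cong₂ _+_ val≡ (+-identityʳ _)) value) ,
    greedy-++ zl g (subst (λ acc → Greedy t acc (d ∷ [])) (sym val≡)
      (m%n<n x (U t) , subst (_< U (suc t)) (sym value) x<U))
    where
    d<C : x / U t < C
    d<C = *-cancelʳ-< (U t) _ C (≤-<-trans (m/n*n≤m x (U t)) (<-≤-trans x<U (C-bound t)))
    d = fromℕ< d<C
    value : x % U t + toℕ d * U t ≡ x
    value = trans (cong (λ k → x % U t + k * U t) (toℕ-fromℕ< d<C)) (sym (m≡m%n+[m/n]*n x (U t)))

  greedy⇒rep : ∀ F → Greedy 0 0 F → LeadingNonzero S (reverse F) → IsRep S (reverse F) (val 0 F)
  greedy⇒rep F g lead =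
    cong (val 0) (reverse-involutive F) ,
    lead ,
    λ t → subst (λ w → val 0 (take (suc t) w) < U (suc t)) (sym (reverse-involutive F)) (greedy⇒prefix< F g (suc t))

  val-zeros : ∀ n b l → val b (replicate n digit0 ++ l) ≡ val (n + b) l
  val-zeros zero    b l = refl
  val-zeros (suc n) b l = begin
    toℕ digit0 * U b + val (suc b) (replicate n digit0 ++ l)   ≡⟨ cong (λ k → k * U b + val (suc b) (replicate n digit0 ++ l)) toℕ-digit0 ⟩
    val (suc b) (replicate n digit0 ++ l)                       ≡⟨ val-zeros n (suc b) l ⟩
    val (n + suc b) l                                           ≡⟨ cong (λ b → val b l) (+-suc n b) ⟩
    val (suc n + b) l                                           ∎
    where open ≡-Reasoning

  greedy-zeros : ∀ n {b acc} l → acc < U b → Greedy (n + b) acc l → Greedy b acc (replicate n digit0 ++ l)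
  greedy-zeros zero    l _     g = g
  greedy-zeros (suc n) {b} {acc} l acc<U g =
    acc<U ,
    subst (λ acc → Greedy (suc b) acc (replicate n digit0 ++ l))
      (sym (trans (cong (λ k → acc + k * U b) toℕ-digit0) (+-identityʳ acc)))
      (greedy-zeros n l (<-≤-trans acc<U (U-mono (n≤1+n b))) (subst (λ b → Greedy b acc l) (sym (+-suc n b)) g))

  gap : ℕ → ℕ
  gap i = U (suc i) ∸ U i

  -- A digit 1 at position q keeps greedy any word whose part below position b is greedy.
  _◃_ : ℕ → ℕ → Set
  b ◃ q = b ≤ q × U b ≤ gap q

  ◃-trans : ∀ {a b c} → suc a ◃ b → suc b ◃ c → suc a ◃ c
  ◃-trans (a<b , Ua≤gap) (b<c , Ub≤gap) =
    ≤-trans a<b (≤-trans (n≤1+n _) b<c) , ≤-trans Ua≤gap (≤-trans (m∸n≤m (U (suc _)) (U _)) Ub≤gap)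

  Spaced : ℕ → List ℕ → Set
  Spaced b []       = ⊤
  Spaced b (q ∷ qs) = b ◃ q × Spaced (suc q) qs

  onesFrom : ℕ → List ℕ → Word S
  onesFrom b []       = []
  onesFrom b (q ∷ qs) = replicate (q ∸ b) digit0 ++ digit1 ∷ onesFrom (suc q) qs

  val-onesFrom : ∀ b qs → Spaced b qs → val b (onesFrom b qs) ≡ sum (map U qs)
  val-onesFrom b []       _                   = refl
  val-onesFrom b (q ∷ qs) ((b≤q , _) , spaced) = begin
    val b (replicate (q ∸ b) digit0 ++ digit1 ∷ onesFrom (suc q) qs)   ≡⟨ val-zeros (q ∸ b) b _ ⟩
    val (q ∸ b + b) (digit1 ∷ onesFrom (suc q) qs)                     ≡⟨ cong (λ b → val b (digit1 ∷ onesFrom (suc q) qs)) (m∸n+n≡m b≤q) ⟩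
    toℕ digit1 * U q + val (suc q) (onesFrom (suc q) qs)               ≡⟨ cong₂ _+_ (trans (cong (_* U q) toℕ-digit1) (*-identityˡ (U q)))
                                                                                     (val-onesFrom (suc q) qs spaced) ⟩
    U q + sum (map U qs)                                               ∎
    where open ≡-Reasoning

  greedy-onesFrom : ∀ b {acc} qs → acc < U b → Spaced b qs → Greedy b acc (onesFrom b qs)
  greedy-onesFrom b       []       acc<U _                                = acc<U
  greedy-onesFrom b {acc} (q ∷ qs) acc<U ((b≤q , Ub≤gap) , spaced) =
    greedy-zeros (q ∸ b) _ acc<U (subst (λ b′ → Greedy b′ acc (digit1 ∷ onesFrom (suc q) qs)) (sym (m∸n+n≡m b≤q))
      (<-≤-trans acc<U (U-mono b≤q) , greedy-onesFrom (suc q) qs acc+Uq<U spaced))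
    where
    acc+Uq<U : acc + toℕ digit1 * U q < U (suc q)
    acc+Uq<U = subst (λ k → acc + k < U (suc q)) (sym (trans (cong (_* U q) toℕ-digit1) (*-identityˡ (U q))))
                 (<-≤-trans (+-monoˡ-< (U q) (<-≤-trans acc<U Ub≤gap)) (≤-reflexive (m∸n+n≡m (<⇒≤ (incr q)))))

  onesFrom-ends-in-1 : ∀ b q qs → ∃[ l ] onesFrom b (q ∷ qs) ≡ l ++ digit1 ∷ []
  onesFrom-ends-in-1 b q []        = replicate (q ∸ b) digit0 , refl
  onesFrom-ends-in-1 b q (q′ ∷ qs) with l , ≡l++1 ← onesFrom-ends-in-1 (suc q) q′ qs =
    replicate (q ∸ b) digit0 ++ digit1 ∷ l ,
    trans (cong (λ w → replicate (q ∸ b) digit0 ++ digit1 ∷ w) ≡l++1) (sym (++-assoc (replicate (q ∸ b) digit0) (digit1 ∷ l) _))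

  greedy-end : ∀ {acc} l → Greedy 0 acc l → acc + val 0 l < U (length l)
  greedy-end {acc} l g = subst (λ w → acc + val 0 w < U (length l)) (take-all (length l) l ≤-refl) (greedy⇒prefix< l g (length l))

  paddedOnes-rep : ∀ {t zl} qs → qs ≢ [] → length zl ≡ t → Greedy 0 0 zl → Spaced t qs →
                   IsRep S (reverse (zl ++ onesFrom t qs)) (val 0 zl + sum (map U qs))
  paddedOnes-rep []       []≢[] _    _ _      = contradiction refl []≢[]
  paddedOnes-rep {t} {zl} (q ∷ qs) _ refl g spaced =
    subst (IsRep S (reverse F)) value (greedy⇒rep F greedy (subst (LeadingNonzero S) (sym leading) digit1≢0))
    where
    F = zl ++ onesFrom t (q ∷ qs)
    value : val 0 F ≡ val 0 zl + sum (map U (q ∷ qs))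
    value = trans (val-++ 0 zl _) (cong (val 0 zl +_) (val-onesFrom t (q ∷ qs) spaced))
    greedy : Greedy 0 0 F
    greedy = greedy-++ zl g (greedy-onesFrom t (q ∷ qs) (greedy-end zl g) spaced)
    l = proj₁ (onesFrom-ends-in-1 t q qs)
    leading : reverse F ≡ digit1 ∷ reverse (zl ++ l)
    leading = trans (cong (λ w → reverse (zl ++ w)) (proj₂ (onesFrom-ends-in-1 t q qs)))
                (trans (cong reverse (sym (++-assoc zl l _))) (reverse-++ (zl ++ l) _))
    digit1≢0 : toℕ digit1 ≢ 0
    digit1≢0 e = 1+n≢0 (trans (sym toℕ-digit1) e)

  -- Every x < U t has greedy digits of length t, and these are read last: two high parts
  -- reaching the same state accept the same low parts.
  same-state⇒same-membership :
    ∀ {m} {D : DFA m C} {X : ℕ → Set} → Recognizes D (RepLang S X) →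
    ∀ {t qs qs′} → qs ≢ [] → qs′ ≢ [] → Spaced t qs → Spaced t qs′ →
    run D (DFA.init D) (reverse (onesFrom t qs)) ≡ run D (DFA.init D) (reverse (onesFrom t qs′)) →
    ∀ x → x < U t → X (x + sum (map U qs)) → X (x + sum (map U qs′))
  same-state⇒same-membership {X = X} rec {t} {qs} {qs′} qs≢[] qs′≢[] spaced spaced′ same x x<U x+Σqs∈X
    with zl , len , val≡ , g ← paddedDigits t x x<U =
    let n , n∈X , n-rep = subst (RepLang S X) (sym (reverse-++ zl (onesFrom t qs′)))
                            (recognizes-residual rec same (reverse zl)
                              (subst (RepLang S X) (reverse-++ zl (onesFrom t qs)) (_ , x+Σqs∈X , rep qs qs≢[] spaced)))
    in  subst X (trans (sym (proj₁ n-rep)) (proj₁ (rep qs′ qs′≢[] spaced′))) n∈X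
    where
    rep : ∀ qs → qs ≢ [] → Spaced t qs → IsRep S (reverse (zl ++ onesFrom t qs)) (x + sum (map U qs))
    rep qs qs≢[] spaced = subst (λ v → IsRep S _ (v + sum (map U qs))) val≡ (paddedOnes-rep qs qs≢[] len g spaced)

  gap-eventually-≥ : H2 S → H3 S → ∀ B → ∃[ M ] ∀ i → M ≤ i → B ≤ gap i
  gap-eventually-≥ h2 (G , gap-mono) B with i , G≤i , B≤gap ← h2 B G =
    i , λ j i≤j → ≤-trans B≤gap (mono-from gap gap-mono G≤i i≤j)

  spaced-sequence : H2 S → H3 S → ∀ {P : ℕ → Set} → (∀ M → ∃[ i ] (M ≤ i × P i)) → ∀ B →
                    Σ[ x ∈ (ℕ → ℕ) ] (∀ n → B ≤ x n × P (x n)) × (∀ {i j} → i < j → suc (x i) ◃ x j)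
  spaced-sequence h2 h3 {P} often B = x , x-good , chain
    where
    threshold : ℕ → ℕ
    threshold b = proj₁ (gap-eventually-≥ h2 h3 b)
    bound : ℕ → ℕ
    bound q = B ⊔ suc q ⊔ threshold (U (suc q))
    after : ℕ → ℕ
    after q = proj₁ (often (bound q))
    bound≤after : ∀ q → bound q ≤ after q
    bound≤after q = proj₁ (proj₂ (often (bound q)))
    ◃-after : ∀ q → suc q ◃ after q
    ◃-after q = ≤-trans (≤-trans (m≤n⊔m B (suc q)) (m≤m⊔n _ _)) (bound≤after q) ,
                proj₂ (gap-eventually-≥ h2 h3 _) (after q) (≤-trans (m≤n⊔m (B ⊔ suc q) _) (bound≤after q))
    x : ℕ → ℕ
    x zero    = proj₁ (often B)
    x (suc n) = after (x n)
    x-good : ∀ n → B ≤ x n × P (x n)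
    x-good zero    = proj₂ (often B)
    x-good (suc n) = ≤-trans (≤-trans (m≤m⊔n B _) (m≤m⊔n _ _)) (bound≤after (x n)) , proj₂ (proj₂ (often _))
    chain′ : ∀ {i j} → suc i ≤′ j → suc (x i) ◃ x j
    chain′ ≤′-refl         = ◃-after _
    chain′ (≤′-step i<′j) = ◃-trans (chain′ i<′j) (◃-after _)
    chain : ∀ {i j} → i < j → suc (x i) ◃ x j
    chain i<j = chain′ (≤⇒≤′ i<j)

  allPairs⇒spaced : ∀ {b qs} → All (b ◃_) qs → AllPairs (λ a c → suc a ◃ c) qs → Spaced b qs
  allPairs⇒spaced []             []               = tt
  allPairs⇒spaced (b◃q ∷ b◃qs) (q◃qs ∷ pairs) = b◃q , allPairs⇒spaced q◃qs pairs

  spaced-take : ∀ n {b qs} → Spaced b qs → Spaced b (take n qs)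
  spaced-take zero                 _              = tt
  spaced-take (suc n) {qs = []}    _              = tt
  spaced-take (suc n) {qs = _ ∷ _} (b◃q , spaced) = b◃q , spaced-take n spaced

-- The lower bound

module LowerBound
  (S : NumSys) (h2 : H2 S) (h3 : H3 S) {p : ℕ} (p-prime : Prime p) {λ' v : ℕ} (v≢0 : v ≢ 0)
  (often-v : ∀ M → ∃[ i ] (M ≤ i × NumSys.U S i mod (p ^ λ') ≡ v))
  {χ : ℕ → Bool} {μ r : ℕ} (period : IsPeriod χ (p ^ μ * r)) (λ≤μ : λ' ≤ μ)
  {m : ℕ} (D : DFA m (NumSys.C S)) (rec : Recognizes D (RepLang S (λ n → χ n ≡ true))) where

  open NumSys S
  open NumerationSystem S

  private instance
    p≢0 : NonZero p
    p≢0 = prime⇒nonZero p-prime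
    pᵘ≢0 : NonZero (p ^ μ)
    pᵘ≢0 = m^n≢0 p μ
    pˡ≢0 : NonZero (p ^ λ')
    pˡ≢0 = m^n≢0 p λ'
    π≢0 : NonZero (p ^ μ * r)
    π≢0 = >-nonZero (proj₁ (proj₁ period))

  P π M₀ : ℕ
  P = p ^ μ
  π = P * r
  M₀ = proj₁ (proj₂ (proj₁ period))

  B : ℕ
  B = M₀ ⊔ π ⊔ proj₁ (gap-eventually-≥ h2 h3 (U π))

  -- admissible positions for the digits 1: past the preperiod, compatible with any
  -- digits below position π, and carrying the residue v modulo p ^ λ'
  Admissible : ℕ → Set
  Admissible q = B ≤ q × U q mod (p ^ λ') ≡ v

  positions : Σ[ x ∈ (ℕ → ℕ) ] (∀ n → Admissible (x n)) × (∀ {i j} → i < j → suc (x i) ◃ x j)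
  positions = spaced-sequence h2 h3 often-v B

  pos : ℕ → ℕ
  pos = proj₁ positions

  colour : ℕ → ℕ
  colour q = U q % P

  candidates : List ℕ
  candidates = applyUpTo pos (suc (P * m))

  monochromatic : ∃[ ρ ] m < length (ofColour colour ρ candidates)
  monochromatic = colour-pigeonhole colour P m candidates (All.applyUpTo⁺₂ pos _ (λ n → m%n<n _ P))
                    (≤-reflexive (sym (length-applyUpTo pos _)))

  ρ : ℕ
  ρ = proj₁ monochromatic

  ys : List ℕ
  ys = ofColour colour ρ candidates

  m<|ys| : m < length ys
  m<|ys| = proj₂ monochromatic

  ys-admissible : All Admissible ys
  ys-admissible = All.filter⁺ (λ q → colour q ≟ ρ) (All.applyUpTo⁺₂ pos _ (proj₁ (proj₂ positions)))

  ys-colour : All (λ q → colour q ≡ ρ) ys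
  ys-colour = All.all-filter (λ q → colour q ≟ ρ) candidates

  ys-spaced : Spaced π ys
  ys-spaced = allPairs⇒spaced (All.map π◃ ys-admissible)
                (AllPairs.filter⁺ (λ q → colour q ≟ ρ) (AllPairs.applyUpTo⁺₁ pos _ (λ i<j _ → proj₂ (proj₂ positions) i<j)))
    where
    π◃ : ∀ {q} → Admissible q → π ◃ q
    π◃ (B≤q , _) = ≤-trans (m≤n⊔m M₀ π) (≤-trans (m≤m⊔n _ _) B≤q) ,
                   proj₂ (gap-eventually-≥ h2 h3 (U π)) _ (≤-trans (m≤n⊔m (M₀ ⊔ π) _) B≤q)

  state : Fin (suc m) → Fin m
  state c = run D (DFA.init D) (reverse (onesFrom π (take (suc (toℕ c)) ys)))

  collision : ∃₂ λ i j → i Fin.< j × state i ≡ state j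
  collision = pigeonhole (n<1+n m) state

  i j : Fin (suc m)
  i = proj₁ collision
  j = proj₁ (proj₂ collision)

  a b : ℕ
  a = suc (toℕ i)
  b = suc (toℕ j)

  a<b : a < b
  a<b = s≤s (proj₁ (proj₂ (proj₂ collision)))

  b≤|ys| : b ≤ length ys
  b≤|ys| = ≤-trans (toℕ<n j) m<|ys|

  middle : List ℕ
  middle = drop a (take b ys)

  Σa Σb Σmiddle : ℕ
  Σa = sum (map U (take a ys))
  Σb = sum (map U (take b ys))
  Σmiddle = sum (map U middle)

  Σb≡Σa+Σmiddle : Σb ≡ Σa + Σmiddle
  Σb≡Σa+Σmiddle = begin
    sum (map U (take b ys))                                 ≡⟨ cong (λ l → sum (map U l)) (sym (take++drop≡id a (take b ys))) ⟩
    sum (map U (take a (take b ys) ++ middle))              ≡⟨ cong (λ l → sum (map U (l ++ middle))) (trans (take-take a b ys) (cong (λ k → take k ys) (m≤n⇒m⊓n≡m (<⇒≤ a<b)))) ⟩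
    sum (map U (take a ys ++ middle))                       ≡⟨ cong sum (map-++ U (take a ys) middle) ⟩
    sum (map U (take a ys) ++ map U middle)                 ≡⟨ sum-++ (map U (take a ys)) _ ⟩
    Σa + Σmiddle                                            ∎
    where open ≡-Reasoning

  |middle| : length middle ≡ b ∸ a
  |middle| = trans (length-drop a (take b ys)) (cong (_∸ a) (trans (length-take b ys) (m≤n⇒m⊓n≡m b≤|ys|)))

  prefix-spaced : ∀ n → Spaced π (take n ys)
  prefix-spaced n = spaced-take n ys-spaced

  ys≢[] : ys ≢ []
  ys≢[] ys≡[] = contradiction (subst (m <_) (cong length ys≡[]) m<|ys|) λ ()

  prefix≢[] : ∀ n → take (suc n) ys ≢ []
  prefix≢[] n = take-suc-≢[] n ys≢[]

  window-agreement : ∀ x → x < π → χ (x + Σa) ≡ χ (x + Σa + Σmiddle)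
  window-agreement x x<π = ⇔→≡ (mk⇔
    (λ χa → subst (λ n → χ n ≡ true) shift (member same χa))
    (λ χb → member (sym same) (subst (λ n → χ n ≡ true) (sym shift) χb)))
    where
    same = proj₂ (proj₂ (proj₂ collision))
    shift : x + Σb ≡ x + Σa + Σmiddle
    shift = trans (cong (x +_) Σb≡Σa+Σmiddle) (sym (+-assoc x Σa Σmiddle))
    member : ∀ {c c′} → state c ≡ state c′ →
             χ (x + sum (map U (take (suc (toℕ c)) ys))) ≡ true → χ (x + sum (map U (take (suc (toℕ c′)) ys))) ≡ true
    member {c} {c′} same = same-state⇒same-membership rec (prefix≢[] (toℕ c)) (prefix≢[] (toℕ c′))
                             (prefix-spaced _) (prefix-spaced _) same x (<-trans x<π (n<U π))

  π∣Σmiddle : π ∣ Σmiddle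
  π∣Σmiddle = minimal-period-∣ period
    (window⇒period (proj₂ (proj₂ (proj₁ period))) M₀≤Σa window-agreement)
    where
    M₀≤Σa : M₀ ≤ Σa
    M₀≤Σa = sum-map-≥ U (All.take⁺ a (All.map M₀≤U ys-admissible)) (prefix≢[] _)
      where
      M₀≤U : ∀ {q} → Admissible q → M₀ ≤ U q
      M₀≤U (B≤q , _) = ≤-trans (≤-trans (m≤m⊔n M₀ π) (m≤m⊔n _ _)) (≤-trans B≤q (<⇒≤ (n<U _)))

  representative : ∃ λ y → Admissible y × colour y ≡ ρ
  representative = ∃-from-All (All.zip (ys-admissible , ys-colour)) ys≢[]

  y : ℕ
  y = proj₁ representative

  P∣|middle|*Uy : P ∣ length middle * U y
  P∣|middle|*Uy = m%n≡0⇒n∣m _ P (begin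
    (length middle * U y) % P   ≡⟨ sum-map-% U middle (All.map same-colour (All.drop⁺ a (All.take⁺ b ys-colour))) ⟨
    Σmiddle % P                 ≡⟨ n∣m⇒m%n≡0 _ P (∣-trans (m∣m*n r) π∣Σmiddle) ⟩
    0                           ∎)
    where
    open ≡-Reasoning
    same-colour : ∀ {q} → colour q ≡ ρ → colour q ≡ colour y
    same-colour q≡ρ = trans q≡ρ (sym (proj₂ (proj₂ representative)))

  pˡ∤Uy : ¬ p ^ λ' ∣ U y
  pˡ∤Uy pˡ∣Uy = v≢0 (begin
    v                  ≡⟨ proj₂ (proj₁ (proj₂ representative)) ⟨
    U y mod (p ^ λ')   ≡⟨ mod≡% (U y) (p ^ λ') ⟩
    U y % (p ^ λ')     ≡⟨ n∣m⇒m%n≡0 _ _ pˡ∣Uy ⟩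
    0                  ∎)
    where open ≡-Reasoning

  states-≥ : p ^ (μ ∸ λ' + 1) ≤ m
  states-≥ = begin
    p ^ (μ ∸ λ' + 1)   ≤⟨ ∣⇒≤ ⦃ >-nonZero |middle|>0 ⦄ (prime^∣-cancel p-prime λ' (μ ∸ λ')
                            (subst (λ k → p ^ k ∣ length middle * U y) (sym (m∸n+n≡m λ≤μ)) P∣|middle|*Uy) pˡ∤Uy) ⟩
    length middle      ≡⟨ |middle| ⟩
    b ∸ a              ≤⟨ ≤-trans (m∸n≤m (toℕ j) (toℕ i)) (≤-pred (toℕ<n j)) ⟩
    m                  ∎
    where
    open ≤-Reasoning
    |middle|>0 : 0 < length middle
    |middle|>0 = subst (0 <_) (sym |middle|) (m<n⇒0<n∸m a<b)

proposition4p5 : (S : NumSys) (k : ℕ) (a : Fin k → ℤ) (N : ℕ) →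
    IsLinearWith (NumSys.U S) k a N → H1 S → H2 S → H3 S →
    (p : ℕ) → Prime p → ¬ (∀ j → p ∣ ∣ a j ∣) →
    (λ' : ℕ) → 1 ≤ λ' → PeriodicPartHasNonzero (λ i → NumSys.U S i mod (p ^ λ')) →
    (χ : ℕ → Bool) → Regular (RepLang S (λ n → χ n ≡ true)) →
    (μ r : ℕ) → IsPeriod χ (p ^ μ * r) → λ' ≤ μ → ¬ (p ∣ r) →
    MinAutAtLeast (RepLang S (λ n → χ n ≡ true)) (p ^ (μ ∸ λ' + 1))
proposition4p5 S _ _ _ _ _ h2 h3 p p-prime _ λ' _ (v , v≢0 , often-v) χ _ μ r period λ≤μ _ m D rec =
  LowerBound.states-≥ S h2 h3 p-prime v≢0 often-v period λ≤μ D rec
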